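{- Let $m = p_1^{e_1}\cdots p_r^{e_r}$, $R=\{1,\dots,r\}$, $I\subseteq R$, $U = (\mathbb{Z}/m\mathbb{Z})^\times$, and let $C_I$ be the connected component of the sequential power graph of $\mathbb{Z}/m\mathbb{Z}$ containing $d_I$. Then $C_I$ contains $d_I U = \{d_I u : u\in U\}$; $d_IU$ is the unique set of the form $dU$ with $d$ idempotent contained in $C_I$; and $d_IU$ is exactly the set of elements of $C_I$ that lie in a cycle (i.e. the elements $v \in C_I$ with $v^{k+1} \equiv v \pmod m$ for some $k \ge 1$).
   Context: $m = p_1^{e_1}\cdots p_r^{e_r}$ with distinct primes, $e_i \ge 1$. For $I\subseteq R$, $d_I$ is the idempotent of $\mathbb{Z}/m\mathbb{Z}$ with $d_I \equiv 0 \pmod{p_i^{e_i}}$ for $i\in I$ and $d_I\equiv 1 \pmod{p_j^{e_j}}$ for $j\notin I$. The sequential power graph of $\mathbb{Z}/m\mathbb{Z}$ is the directed graph on $\mathbb{Z}/m\mathbb{Z}$ with an edge $(b,c)$ iff $b\equiv a^i$, $c\equiv a^{i+1}\pmod m$ for some $a$ and $i\in\mathbb{N}$; connected components are with respect to undirected paths. For $a\in\mathbb{Z}/m\mathbb{Z}$, with $j,\ell\ge1$ least such that $a^{j+\ell}\equiv a^j$, the cycle of the orbit of $a$ is $a^j,\dots,a^{j+\ell-1}$. -}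

module Defs where

open import Data.Nat using (ℕ; zero; suc; _+_; _*_; _^_; _<_; _≤_)
open import Data.Fin using (Fin; zero; suc)
open import Data.Product using (∃; ∃-syntax; _×_)
open import Data.Sum using (_⊎_)
open import Relation.Binary.PropositionalEquality using (_≡_)
open import Relation.Binary.Construct.Closure.Equivalence using (EqClosure)

ModEq : ℕ → ℕ → ℕ → Set
ModEq n a b = ∃[ k ] (a ≡ b + k * n ⊎ b ≡ a + k * n)

prodFin : (r : ℕ) → (Fin r → ℕ) → ℕ
prodFin zero    f = 1
prodFin (suc r) f = f zero * prodFin r (λ i → f (suc i))

-- Elements of ℤ/mℤ are represented by their canonical representatives x < m.

Edge : ℕ → ℕ → ℕ → Set
Edge m b c = b < m × c < m ×
  ∃[ a ] ∃[ i ] (1 ≤ i × ModEq m (b) (a ^ i) × ModEq m c (a ^ suc i))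

Connected : ℕ → ℕ → ℕ → Set
Connected m = EqClosure (Edge m)

InComponent : ℕ → ℕ → ℕ → Set
InComponent m d v = v < m × Connected m d v

IsUnit : ℕ → ℕ → Set
IsUnit m u = u < m × ∃[ w ] (ModEq m (u * w) 1)

IsIdempotent : ℕ → ℕ → Set
IsIdempotent m e = e < m × ModEq m (e * e) e

InMulUnits : ℕ → ℕ → ℕ → Set
InMulUnits m d x = x < m × ∃[ u ] (IsUnit m u × ModEq m (x) (d * u))

InCycle : ℕ → ℕ → Set
InCycle m v = ∃[ k ] (1 ≤ k × ModEq m (v ^ suc k) (v))

module Submission where

-- The prime factorisation of m only serves to show that d_I is idempotent
-- (Chinese remainder theorem: every p_i^e_i divides d_I (d_I − 1), hence so
-- does their product m).  Everything else holds for an arbitrary idempotent d.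
--
-- The key tool is the stabilising exponent N = m!.  By pigeonhole the powers
-- of any a become periodic after at most m steps with a period t ≤ m, so
-- a^(2N) ≡ a^N.  Consequently the "projection" a ↦ a^N is unchanged along
-- every edge (a^i, a^(i+1)) of the graph, hence constant on components; it
-- sends units to 1 and fixes idempotents.  From this:
--   (1) x = d u has x^N ≡ d, and x is joined to x^N by its own orbit;
--   (2) an idempotent f in the component of d satisfies f ≡ f^N ≡ d^N ≡ d;
--   (3) an element v with v^(k+1) ≡ v in the component of d has v^k ≡ d,
--       so v = v d and v has an inverse relative to d, which makes
--       u = v + (1 − d) a unit with v = d u.

open import Defs
open import Data.Nat using (ℕ; _^_; _≤_; _<_)
open import Data.Nat.Primality using (Prime)
open import Data.Fin using (Fin)
open import Data.Fin.Subset using (Subset; _∈_; _∉_)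
open import Data.Product using (_×_)
open import Function.Bundles using (_⇔_)
open import Function.Definitions using (Injective)
open import Relation.Binary.PropositionalEquality using (_≡_)

open import Level using (0ℓ)
open import Data.Nat.Base using (zero; suc; _+_; _*_; _∸_; _!; NonZero; >-nonZero; >-nonZero⁻¹; s≤s; z≤n; nonTrivial⇒≢1)
open import Data.Nat.Properties
open import Data.Nat.DivMod using (_%_; _/_; _mod_; m≡m%n+[m/n]*n; m%n<n; m%n%n≡m%n; [m+n]%n≡m%n; [m+kn]%n≡m%n; m<n⇒m%n≡m; %-distribˡ-+; %-distribˡ-*)
open import Data.Nat.Divisibility using (_∣_; divides; ∣-refl; ∣-trans; _∣0; 1∣_; ∣1⇒≡1; ∣⇒≤; m∣m*n; ∣m⇒∣m*n; ∣n⇒∣m*n; *-cancelˡ-∣; m≤n⇒m!∣n!)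
open import Data.Nat.Primality using (euclidsLemma; prime⇒irreducible; prime⇒nonZero; prime⇒nonTrivial)
import Data.Fin as Fin
open import Data.Fin.Properties using (pigeonhole; toℕ-fromℕ<; toℕ<n) renaming (0≢1+n to zero≢suc; suc-injective to Fin-suc-injective)
open import Data.Fin.Subset.Properties using (_∈?_)
open import Data.Product using (_,_; ∃₂; proj₁; proj₂)
open import Data.Sum using (inj₁; inj₂)
open import Data.Empty using (⊥-elim)
open import Relation.Nullary using (¬_; yes; no)
open import Relation.Binary.PropositionalEquality using (_≢_; refl; sym; trans; cong; cong₂; subst; subst₂; isEquivalence; module ≡-Reasoning)
open import Relation.Binary.Bundles using (Setoid)
import Relation.Binary.Reasoning.Setoid as SetoidReasoning
open import Relation.Binary.Construct.Closure.Equivalence using (gfold; return; symmetric)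
open import Relation.Binary.Construct.Closure.ReflexiveTransitive using (ε; _◅◅_)
open import Function.Bundles using (mk⇔)
import Algebra.Properties.CommutativeSemigroup *-commutativeSemigroup as *-Comm
import Algebra.Properties.CommutativeSemigroup +-commutativeSemigroup as +-Comm

^-distribʳ-* : ∀ a b n → (a * b) ^ n ≡ a ^ n * b ^ n
^-distribʳ-* a b zero    = refl
^-distribʳ-* a b (suc n) = begin
  a * b * (a * b) ^ n      ≡⟨ cong (a * b *_) (^-distribʳ-* a b n) ⟩
  a * b * (a ^ n * b ^ n)  ≡⟨ *-Comm.interchange a b (a ^ n) (b ^ n) ⟩
  a * a ^ n * (b * b ^ n)  ∎
  where open ≡-Reasoning

module Congruence (m : ℕ) .{{_ : NonZero m}} where

  infix 4 _≋_

  _≋_ : ℕ → ℕ → Set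
  a ≋ b = a % m ≡ b % m

  ≋-setoid : Setoid 0ℓ 0ℓ
  ≋-setoid = record
    { Carrier       = ℕ
    ; _≈_           = _≋_
    ; isEquivalence = record { refl = refl ; sym = sym ; trans = trans }
    }

  module ≋-Reasoning = SetoidReasoning ≋-setoid
  open Setoid ≋-setoid public using () renaming (refl to ≋-refl; sym to ≋-sym; trans to ≋-trans)

  ≡⇒≋ : ∀ {a b} → a ≡ b → a ≋ b
  ≡⇒≋ = cong (_% m)

  %-≋ : ∀ a → a % m ≋ a
  %-≋ a = m%n%n≡m%n a m

  ModEq⇒≋ : ∀ {a b} → ModEq m a b → a ≋ b
  ModEq⇒≋ {a} {b} (k , inj₁ a≡b+km) = trans (cong (_% m) a≡b+km) ([m+kn]%n≡m%n b k m)
  ModEq⇒≋ {a} {b} (k , inj₂ b≡a+km) = sym (trans (cong (_% m) b≡a+km) ([m+kn]%n≡m%n a k m))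

  ≋-with-larger-quotient : ∀ a b → a ≋ b → b / m ≤ a / m → a ≡ b + (a / m ∸ b / m) * m
  ≋-with-larger-quotient a b a≋b b/m≤a/m = begin
    a                                             ≡⟨ m≡m%n+[m/n]*n a m ⟩
    a % m + (a / m) * m                           ≡⟨ cong₂ (λ x y → x + y * m) a≋b (sym (m+[n∸m]≡n b/m≤a/m)) ⟩
    b % m + (b / m + (a / m ∸ b / m)) * m         ≡⟨ cong (b % m +_) (*-distribʳ-+ m (b / m) _) ⟩
    b % m + ((b / m) * m + (a / m ∸ b / m) * m)   ≡⟨ +-assoc (b % m) _ _ ⟨
    b % m + (b / m) * m + (a / m ∸ b / m) * m     ≡⟨ cong (_+ (a / m ∸ b / m) * m) (m≡m%n+[m/n]*n b m) ⟨
    b + (a / m ∸ b / m) * m                       ∎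
    where open ≡-Reasoning

  ≋⇒ModEq : ∀ {a b} → a ≋ b → ModEq m a b
  ≋⇒ModEq {a} {b} a≋b with ≤-total (b / m) (a / m)
  ... | inj₁ b/m≤a/m = a / m ∸ b / m , inj₁ (≋-with-larger-quotient a b a≋b b/m≤a/m)
  ... | inj₂ a/m≤b/m = b / m ∸ a / m , inj₂ (≋-with-larger-quotient b a (sym a≋b) a/m≤b/m)

  ≋-+ : ∀ {a b c d} → a ≋ b → c ≋ d → a + c ≋ b + d
  ≋-+ {a} {b} {c} {d} a≋b c≋d = begin
    (a + c) % m              ≡⟨ %-distribˡ-+ a c m ⟩
    (a % m + c % m) % m      ≡⟨ cong₂ (λ x y → (x + y) % m) a≋b c≋d ⟩
    (b % m + d % m) % m      ≡⟨ %-distribˡ-+ b d m ⟨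
    (b + d) % m              ∎
    where open ≡-Reasoning

  ≋-* : ∀ {a b c d} → a ≋ b → c ≋ d → a * c ≋ b * d
  ≋-* {a} {b} {c} {d} a≋b c≋d = begin
    (a * c) % m              ≡⟨ %-distribˡ-* a c m ⟩
    (a % m * (c % m)) % m    ≡⟨ cong₂ (λ x y → (x * y) % m) a≋b c≋d ⟩
    (b % m * (d % m)) % m    ≡⟨ %-distribˡ-* b d m ⟨
    (b * d) % m              ∎
    where open ≡-Reasoning

  ≋-^ : ∀ {a b} n → a ≋ b → a ^ n ≋ b ^ n
  ≋-^ zero    a≋b = refl
  ≋-^ (suc n) a≋b = ≋-* a≋b (≋-^ n a≋b)

  -- Addition modulo m is cancellative (needed to compute with 1 − d inside ℕ).
  +-cancelʳ-≋ : ∀ {a b} c → a + c ≋ b + c → a ≋ b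
  +-cancelʳ-≋ {a} {b} c a+c≋b+c with ≋⇒ModEq a+c≋b+c
  ... | k , inj₁ eq = ModEq⇒≋ (k , inj₁ (+-cancelʳ-≡ c a _ (trans eq (+-Comm.xy∙z≈xz∙y b c (k * m)))))
  ... | k , inj₂ eq = ModEq⇒≋ (k , inj₂ (+-cancelʳ-≡ c b _ (trans eq (+-Comm.xy∙z≈xz∙y a c (k * m)))))

  1-isUnit : IsUnit m (1 % m)
  1-isUnit = m%n<n 1 m , 1 , ≋⇒ModEq (trans (cong (_% m) (*-identityʳ (1 % m))) (%-≋ 1))

  idempotent∈own-class : ∀ {f} → IsIdempotent m f → InMulUnits m f f
  idempotent∈own-class {f} (f<m , _) =
    f<m , 1 % m , 1-isUnit , ≋⇒ModEq (sym (trans (≋-* (≋-refl {f}) (%-≋ 1)) (cong (_% m) (*-identityʳ f))))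

  InMulUnits-resp-≋ : ∀ {d f x} → d ≋ f → InMulUnits m d x → InMulUnits m f x
  InMulUnits-resp-≋ {d} {f} d≋f (x<m , u , u-unit , x≡du) =
    x<m , u , u-unit , ≋⇒ModEq (≋-trans (ModEq⇒≋ x≡du) (≋-* d≋f (≋-refl {u})))

module Stabilisation (m : ℕ) .{{_ : NonZero m}} where
  open Congruence m

  periodic : ∀ a s t → a ^ s ≋ a ^ (s + t) → ∀ c → a ^ (s + c * t) ≋ a ^ s
  periodic a s t repeat zero    = ≡⇒≋ (cong (a ^_) (+-identityʳ s))
  periodic a s t repeat (suc c) = begin
    a ^ (s + (t + c * t))       ≡⟨ cong (a ^_) (+-assoc s t (c * t)) ⟨
    a ^ (s + t + c * t)         ≡⟨ ^-distribˡ-+-* a (s + t) (c * t) ⟩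
    a ^ (s + t) * a ^ (c * t)   ≈⟨ ≋-* (≋-sym repeat) (≋-refl {a ^ (c * t)}) ⟩
    a ^ s * a ^ (c * t)         ≡⟨ ^-distribˡ-+-* a s (c * t) ⟨
    a ^ (s + c * t)             ≈⟨ periodic a s t repeat c ⟩
    a ^ s                       ∎
    where open ≋-Reasoning

  powers-repeat : ∀ a → ∃₂ λ s t → s ≤ m × 1 ≤ t × t ≤ m × a ^ s ≋ a ^ (s + t)
  powers-repeat a with pigeonhole (n<1+n m) (λ j → a ^ suc (Fin.toℕ j) mod m)
  ... | i , j , i<j , same-class =
    suc i′ , j′ ∸ i′ , ≤-trans i<j j′≤m , m<n⇒0<n∸m i<j , ≤-trans (m∸n≤m j′ i′) j′≤m , repeat
    where
    i′ j′ : ℕ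
    i′ = Fin.toℕ i
    j′ = Fin.toℕ j
    j′≤m : j′ ≤ m
    j′≤m = ≤-pred (toℕ<n j)
    repeat : a ^ suc i′ ≋ a ^ (suc i′ + (j′ ∸ i′))
    repeat = begin
      a ^ suc i′ % m                   ≡⟨ toℕ-fromℕ< (m%n<n (a ^ suc i′) m) ⟨
      Fin.toℕ (a ^ suc i′ mod m)       ≡⟨ cong Fin.toℕ same-class ⟩
      Fin.toℕ (a ^ suc j′ mod m)       ≡⟨ toℕ-fromℕ< (m%n<n (a ^ suc j′) m) ⟩
      a ^ suc j′ % m                   ≡⟨ cong (λ k → a ^ suc k % m) (m+[n∸m]≡n (<⇒≤ i<j)) ⟨
      a ^ (suc i′ + (j′ ∸ i′)) % m     ∎
      where open ≡-Reasoning

  -- The stabilising exponent: at least every preperiod, a multiple of every period.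
  N : ℕ
  N = m !

  1≤N : 1 ≤ N
  1≤N = 1≤n! m

  period∣N : ∀ {t} → 1 ≤ t → t ≤ m → t ∣ N
  period∣N {suc t} _ t≤m = ∣-trans (m∣m*n (t !)) (m≤n⇒m!∣n! t≤m)

  preperiod≤N : ∀ {s} → s ≤ m → s ≤ N
  preperiod≤N s≤m = ≤-trans s≤m (∣⇒≤ {{m !≢0}} (period∣N (>-nonZero⁻¹ m) ≤-refl))

  -- Writing N = n + s = c t, a^(2N) = a^n a^(s + c t) ≋ a^n a^s = a^N.
  stable : ∀ a → a ^ (N + N) ≋ a ^ N
  stable a with powers-repeat a
  ... | s , t , s≤m , 1≤t , t≤m , repeat with period∣N 1≤t t≤m
  ... | divides c N≡ct = begin
    a ^ (N + N)               ≡⟨ cong (a ^_) (cong₂ _+_ (sym n+s≡N) N≡ct) ⟩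
    a ^ (n + s + c * t)       ≡⟨ cong (a ^_) (+-assoc n s (c * t)) ⟩
    a ^ (n + (s + c * t))     ≡⟨ ^-distribˡ-+-* a n (s + c * t) ⟩
    a ^ n * a ^ (s + c * t)   ≈⟨ ≋-* (≋-refl {a ^ n}) (periodic a s t repeat c) ⟩
    a ^ n * a ^ s             ≡⟨ ^-distribˡ-+-* a n s ⟨
    a ^ (n + s)               ≡⟨ cong (a ^_) n+s≡N ⟩
    a ^ N                     ∎
    where
    open ≋-Reasoning
    n : ℕ
    n = N ∸ s
    n+s≡N : n + s ≡ N
    n+s≡N = trans (+-comm n s) (m+[n∸m]≡n (preperiod≤N s≤m))

  stable-multiple : ∀ a k → a ^ (suc k * N) ≋ a ^ N
  stable-multiple a zero    = ≡⇒≋ (cong (a ^_) (*-identityˡ N))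
  stable-multiple a (suc k) = begin
    a ^ (N + suc k * N)         ≡⟨ ^-distribˡ-+-* a N (suc k * N) ⟩
    a ^ N * a ^ (suc k * N)     ≈⟨ ≋-* (≋-refl {a ^ N}) (stable-multiple a k) ⟩
    a ^ N * a ^ N               ≡⟨ ^-distribˡ-+-* a N N ⟨
    a ^ (N + N)                 ≈⟨ stable a ⟩
    a ^ N                       ∎
    where open ≋-Reasoning

module Projection (m : ℕ) .{{_ : NonZero m}} where
  open Congruence m
  open Stabilisation m

  idempotent-power : ∀ {e} → e * e ≋ e → ∀ {k} → 1 ≤ k → e ^ k ≋ e
  idempotent-power {e} ee {suc zero}    _ = ≡⇒≋ (*-identityʳ e)
  idempotent-power {e} ee {suc (suc k)} _ = ≋-trans (≋-* (≋-refl {e}) (idempotent-power ee {suc k} (s≤s z≤n))) ee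

  unit-power : ∀ {u w} → u * w ≋ 1 → u ^ N ≋ 1
  unit-power {u} {w} uw≋1 = begin
    u ^ N                           ≡⟨ *-identityʳ (u ^ N) ⟨
    u ^ N * 1                       ≈⟨ ≋-* (≋-refl {u ^ N}) (≋-sym [uw]ᴺ≋1) ⟩
    u ^ N * (u * w) ^ N             ≡⟨ cong (u ^ N *_) (^-distribʳ-* u w N) ⟩
    u ^ N * (u ^ N * w ^ N)         ≡⟨ *-assoc (u ^ N) _ _ ⟨
    u ^ N * u ^ N * w ^ N           ≡⟨ cong (_* w ^ N) (^-distribˡ-+-* u N N) ⟨
    u ^ (N + N) * w ^ N             ≈⟨ ≋-* (stable u) (≋-refl {w ^ N}) ⟩
    u ^ N * w ^ N                   ≡⟨ ^-distribʳ-* u w N ⟨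
    (u * w) ^ N                     ≈⟨ [uw]ᴺ≋1 ⟩
    1                               ∎
    where
    open ≋-Reasoning
    [uw]ᴺ≋1 : (u * w) ^ N ≋ 1
    [uw]ᴺ≋1 = ≋-trans (≋-^ N uw≋1) (≡⇒≋ (^-zeroˡ N))

  projection-of-power : ∀ a {i} → 1 ≤ i → (a ^ i) ^ N ≋ a ^ N
  projection-of-power a {suc i} _ = ≋-trans (≡⇒≋ (^-*-assoc a (suc i) N)) (stable-multiple a i)

  -- Both ends of an edge (a^i, a^(i+1)) project to a^N; so the projection is constant on components.
  edge-invariant : ∀ {b c} → Edge m b c → b ^ N ≋ c ^ N
  edge-invariant {b} {c} (_ , _ , a , i , 1≤i , b≡aⁱ , c≡aⁱ⁺¹) = begin
    b ^ N               ≈⟨ ≋-^ N (ModEq⇒≋ b≡aⁱ) ⟩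
    (a ^ i) ^ N         ≈⟨ projection-of-power a 1≤i ⟩
    a ^ N               ≈⟨ projection-of-power a {suc i} (s≤s z≤n) ⟨
    (a ^ suc i) ^ N     ≈⟨ ≋-^ N (ModEq⇒≋ c≡aⁱ⁺¹) ⟨
    c ^ N               ∎
    where open ≋-Reasoning

  component-invariant : ∀ {x y} → Connected m x y → x ^ N ≋ y ^ N
  component-invariant = gfold isEquivalence (λ x → x ^ N % m) edge-invariant

  orbit-connected : ∀ {x} → x < m → ∀ {j} → 1 ≤ j → Connected m x (x ^ j % m)
  orbit-connected {x} x<m {suc zero} _ =
    subst (Connected m x) (sym (trans (cong (_% m) (*-identityʳ x)) (m<n⇒m%n≡m x<m))) ε
  orbit-connected {x} x<m {suc (suc j)} _ = orbit-connected x<m {suc j} (s≤s z≤n) ◅◅ return orbit-edge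
    where
    orbit-edge : Edge m (x ^ suc j % m) (x ^ suc (suc j) % m)
    orbit-edge = m%n<n _ m , m%n<n _ m , x , suc j , s≤s z≤n , ≋⇒ModEq (%-≋ _) , ≋⇒ModEq (%-≋ _)

  cycle-power-idempotent : ∀ {v} k → v ^ suc (suc k) ≋ v → v ^ suc k * v ^ suc k ≋ v ^ suc k
  cycle-power-idempotent {v} k cycle = begin
    v * v ^ k * v ^ suc k       ≡⟨ *-Comm.xy∙z≈y∙xz v (v ^ k) (v ^ suc k) ⟩
    v ^ k * v ^ suc (suc k)     ≈⟨ ≋-* (≋-refl {v ^ k}) cycle ⟩
    v ^ k * v                   ≡⟨ *-comm (v ^ k) v ⟩
    v ^ suc k                   ∎
    where open ≋-Reasoning

module IdempotentComponent (m : ℕ) .{{_ : NonZero m}} (d : ℕ) (d-idem : IsIdempotent m d) where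
  open Congruence m
  open Stabilisation m
  open Projection m

  d<m : d < m
  d<m = proj₁ d-idem

  d²≋d : d * d ≋ d
  d²≋d = ModEq⇒≋ (proj₂ d-idem)

  -- The complementary idempotent 1 − d, represented by m + 1 − d.
  d̄ : ℕ
  d̄ = suc (m ∸ d)

  d+d̄≋1 : d + d̄ ≋ 1
  d+d̄≋1 = trans (cong (_% m) (trans (+-suc d (m ∸ d)) (cong suc (m+[n∸m]≡n (<⇒≤ d<m))))) ([m+n]%n≡m%n 1 m)

  dd̄≋0 : d * d̄ ≋ 0
  dd̄≋0 = +-cancelʳ-≋ d (begin
    d * d̄ + d          ≈⟨ ≋-+ (≋-refl {d * d̄}) (≋-sym d²≋d) ⟩
    d * d̄ + d * d      ≡⟨ *-distribˡ-+ d d̄ d ⟨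
    d * (d̄ + d)        ≈⟨ ≋-* (≋-refl {d}) (≋-trans (≡⇒≋ (+-comm d̄ d)) d+d̄≋1) ⟩
    d * 1              ≡⟨ *-identityʳ d ⟩
    d                  ∎)
    where open ≋-Reasoning

  d̄d≋0 : d̄ * d ≋ 0
  d̄d≋0 = ≋-trans (≡⇒≋ (*-comm d̄ d)) dd̄≋0

  d̄²≋d̄ : d̄ * d̄ ≋ d̄
  d̄²≋d̄ = +-cancelʳ-≋ (d * d̄) (begin
    d̄ * d̄ + d * d̄      ≡⟨ *-distribʳ-+ d̄ d̄ d ⟨
    (d̄ + d) * d̄        ≈⟨ ≋-* (≋-trans (≡⇒≋ (+-comm d̄ d)) d+d̄≋1) (≋-refl {d̄}) ⟩
    1 * d̄              ≡⟨⟩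
    d̄ + 0              ≈⟨ ≋-+ (≋-refl {d̄}) (≋-sym dd̄≋0) ⟩
    d̄ + d * d̄          ∎)
    where open ≋-Reasoning

  dᴺ≋d : d ^ N ≋ d
  dᴺ≋d = idempotent-power d²≋d 1≤N

  dU-absorbs : ∀ {x} → InMulUnits m d x → x * d ≋ x
  dU-absorbs {x} (_ , u , _ , x≡du) = begin
    x * d          ≈⟨ ≋-* (ModEq⇒≋ x≡du) (≋-refl {d}) ⟩
    d * u * d      ≡⟨ *-Comm.xy∙z≈xz∙y d u d ⟩
    d * d * u      ≈⟨ ≋-* d²≋d (≋-refl {u}) ⟩
    d * u          ≈⟨ ModEq⇒≋ x≡du ⟨
    x              ∎
    where open ≋-Reasoning

  dU-projection : ∀ {x} → InMulUnits m d x → x ^ N ≋ d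
  dU-projection {x} (_ , u , (_ , w , uw≡1) , x≡du) = begin
    x ^ N            ≈⟨ ≋-^ N (ModEq⇒≋ x≡du) ⟩
    (d * u) ^ N      ≡⟨ ^-distribʳ-* d u N ⟩
    d ^ N * u ^ N    ≈⟨ ≋-* dᴺ≋d (unit-power (ModEq⇒≋ uw≡1)) ⟩
    d * 1            ≡⟨ *-identityʳ d ⟩
    d                ∎
    where open ≋-Reasoning

  component-projection : ∀ {v} → Connected m d v → v ^ N ≋ d
  component-projection d~v = ≋-trans (≋-sym (component-invariant d~v)) dᴺ≋d

  -- (1) dU lies in the component of d: x is joined to x^N mod m = d by its orbit.
  dU⊆component : ∀ x → InMulUnits m d x → InComponent m d x
  dU⊆component x x∈dU@(x<m , _) = x<m , symmetric (Edge m) x~d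
    where
    x~d : Connected m x d
    x~d = subst (Connected m x) (trans (dU-projection x∈dU) (m<n⇒m%n≡m d<m)) (orbit-connected x<m 1≤N)

  -- (2) An idempotent f whose fU lies in the component of d satisfies f ≋ f^N ≋ d.
  unique-idempotent-class : ∀ f → IsIdempotent m f → (∀ x → InMulUnits m f x → InComponent m d x) →
                            ∀ x → InMulUnits m f x ⇔ InMulUnits m d x
  unique-idempotent-class f f-idem@(_ , f²≡f) fU⊆component x =
    mk⇔ (InMulUnits-resp-≋ f≋d) (InMulUnits-resp-≋ (≋-sym f≋d))
    where
    f≋d : f ≋ d
    f≋d = ≋-trans (≋-sym (idempotent-power (ModEq⇒≋ f²≡f) 1≤N))
                  (component-projection (proj₂ (fU⊆component f (idempotent∈own-class f-idem))))

  -- If v = v d and v y = d then v ∈ dU, with unit u = v + (1 − d) and inverse d y + (1 − d).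
  relative-inverse⇒dU : ∀ {v} → v < m → v ≋ v * d → ∀ y → v * y ≋ d → InMulUnits m d v
  relative-inverse⇒dU {v} v<m v≋vd y vy≋d = v<m , u , (m%n<n _ m , w , ≋⇒ModEq uw≋1) , ≋⇒ModEq v≋du
    where
    open ≋-Reasoning
    u w : ℕ
    u = (v + d̄) % m
    w = d * y + d̄
    vdy≋d : v * (d * y) ≋ d
    vdy≋d = ≋-trans (≡⇒≋ (*-Comm.x∙yz≈y∙xz v d y)) (≋-trans (≋-* (≋-refl {d}) vy≋d) d²≋d)
    vd̄≋0 : v * d̄ ≋ 0
    vd̄≋0 = begin
      v * d̄              ≈⟨ ≋-* v≋vd (≋-refl {d̄}) ⟩
      v * d * d̄          ≡⟨ *-assoc v d d̄ ⟩
      v * (d * d̄)        ≈⟨ ≋-* (≋-refl {v}) dd̄≋0 ⟩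
      v * 0              ≡⟨ *-zeroʳ v ⟩
      0                  ∎
    d̄dy≋0 : d̄ * (d * y) ≋ 0
    d̄dy≋0 = ≋-trans (≡⇒≋ (sym (*-assoc d̄ d y))) (≋-* d̄d≋0 (≋-refl {y}))
    uw≋1 : u * w ≋ 1
    uw≋1 = begin
      (v + d̄) % m * w                                  ≈⟨ ≋-* (%-≋ (v + d̄)) (≋-refl {w}) ⟩
      (v + d̄) * w                                      ≡⟨ *-distribʳ-+ w v d̄ ⟩
      v * w + d̄ * w                                    ≡⟨ cong₂ _+_ (*-distribˡ-+ v (d * y) d̄) (*-distribˡ-+ d̄ (d * y) d̄) ⟩
      (v * (d * y) + v * d̄) + (d̄ * (d * y) + d̄ * d̄)   ≈⟨ ≋-+ (≋-+ vdy≋d vd̄≋0) (≋-+ d̄dy≋0 d̄²≋d̄) ⟩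
      (d + 0) + (0 + d̄)                                ≡⟨ cong (_+ d̄) (+-identityʳ d) ⟩
      d + d̄                                            ≈⟨ d+d̄≋1 ⟩
      1                                                ∎
    v≋du : v ≋ d * u
    v≋du = begin
      v                  ≈⟨ v≋vd ⟩
      v * d              ≡⟨ +-identityʳ (v * d) ⟨
      v * d + 0          ≈⟨ ≋-+ (≋-refl {v * d}) (≋-sym dd̄≋0) ⟩
      v * d + d * d̄      ≡⟨ cong (_+ d * d̄) (*-comm v d) ⟩
      d * v + d * d̄      ≡⟨ *-distribˡ-+ d v d̄ ⟨
      d * (v + d̄)        ≈⟨ ≋-* (≋-refl {d}) (%-≋ (v + d̄)) ⟨
      d * u              ∎

  -- (3a) A cyclic element v of the component: v^k is idempotent with projection d, so v^k ≋ d.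
  cyclic⇒dU : ∀ v → InComponent m d v × InCycle m v → InMulUnits m d v
  cyclic⇒dU v ((v<m , d~v) , suc k , _ , cycle) =
    relative-inverse⇒dU v<m v≋vd (v ^ k) vᵏ⁺¹≋d
    where
    open ≋-Reasoning
    vᵏ⁺¹≋d : v ^ suc k ≋ d
    vᵏ⁺¹≋d = begin
      v ^ suc k                ≈⟨ idempotent-power (cycle-power-idempotent k (ModEq⇒≋ cycle)) 1≤N ⟨
      (v ^ suc k) ^ N          ≡⟨ ^-*-assoc v (suc k) N ⟩
      v ^ (suc k * N)          ≡⟨ cong (v ^_) (*-comm (suc k) N) ⟩
      v ^ (N * suc k)          ≡⟨ ^-*-assoc v N (suc k) ⟨
      (v ^ N) ^ suc k          ≈⟨ ≋-^ (suc k) (component-projection d~v) ⟩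
      d ^ suc k                ≈⟨ idempotent-power d²≋d {suc k} (s≤s z≤n) ⟩
      d                        ∎
    v≋vd : v ≋ v * d
    v≋vd = ≋-trans (≋-sym (ModEq⇒≋ cycle)) (≋-* (≋-refl {v}) vᵏ⁺¹≋d)

  -- (3b) Every x ∈ dU lies on a cycle: x^(N+1) ≋ x d ≋ x.
  dU⇒cyclic : ∀ x → InMulUnits m d x → InComponent m d x × InCycle m x
  dU⇒cyclic x x∈dU = dU⊆component x x∈dU , N , 1≤N ,
    ≋⇒ModEq (≋-trans (≋-* (≋-refl {x}) (dU-projection x∈dU)) (dU-absorbs x∈dU))

  cyclic-in-component⇔dU : ∀ v → (InComponent m d v × InCycle m v) ⇔ InMulUnits m d v
  cyclic-in-component⇔dU v = mk⇔ (cyclic⇒dU v) (dU⇒cyclic v)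

module PrimePowerProducts where

  prime≢1 : ∀ {p} → Prime p → p ≢ 1
  prime≢1 p-prime = nonTrivial⇒≢1 {{prime⇒nonTrivial p-prime}}

  prime-power-step : ∀ {p P q} e → Prime p → ¬ p ∣ P → p ^ suc e ∣ q * (p ^ e * P) → p ∣ q
  prime-power-step {p} {P} {q} e p-prime p∤P pᵉ⁺¹∣ with euclidsLemma P q p-prime p∣Pq
    where
    instance _ = m^n≢0 p e {{prime⇒nonZero p-prime}}
    p∣Pq : p ∣ P * q
    p∣Pq = *-cancelˡ-∣ (p ^ e)
      (subst₂ _∣_ (*-comm p (p ^ e)) (*-Comm.x∙yz≈y∙zx q (p ^ e) P) pᵉ⁺¹∣)
  ... | inj₁ p∣P = ⊥-elim (p∤P p∣P)
  ... | inj₂ p∣q = p∣q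

  prime-power-∣ : ∀ {p P X} → Prime p → ¬ p ∣ P → ∀ e → p ^ e ∣ X → P ∣ X → p ^ e * P ∣ X
  prime-power-∣ {P = P} {X} _ _ zero _ P∣X = subst (_∣ X) (sym (*-identityˡ P)) P∣X
  prime-power-∣ {p} {P} {X} p-prime p∤P (suc e) pᵉ⁺¹∣X P∣X
    with prime-power-∣ p-prime p∤P e (∣-trans (∣n⇒∣m*n p ∣-refl) pᵉ⁺¹∣X) P∣X
  ... | divides q X≡q·pᵉP with prime-power-step {q = q} e p-prime p∤P (subst (p ^ suc e ∣_) X≡q·pᵉP pᵉ⁺¹∣X)
  ... | divides r q≡r·p = divides r (begin
    X                        ≡⟨ X≡q·pᵉP ⟩
    q * (p ^ e * P)          ≡⟨ cong (_* (p ^ e * P)) q≡r·p ⟩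
    r * p * (p ^ e * P)      ≡⟨ *-assoc r p (p ^ e * P) ⟩
    r * (p * (p ^ e * P))    ≡⟨ cong (r *_) (*-assoc p (p ^ e) P) ⟨
    r * (p * p ^ e * P)      ∎)
    where open ≡-Reasoning

  prime∤power-of-other-prime : ∀ {p q} → Prime p → Prime q → p ≢ q → ∀ e → ¬ p ∣ q ^ e
  prime∤power-of-other-prime p-prime _ _ zero p∣1 = prime≢1 p-prime (∣1⇒≡1 p∣1)
  prime∤power-of-other-prime {p} {q} p-prime q-prime p≢q (suc e) p∣qᵉ⁺¹
    with euclidsLemma q (q ^ e) p-prime p∣qᵉ⁺¹
  ... | inj₂ p∣qᵉ = prime∤power-of-other-prime p-prime q-prime p≢q e p∣qᵉ
  ... | inj₁ p∣q with prime⇒irreducible q-prime p∣q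
  ...   | inj₁ p≡1 = prime≢1 p-prime p≡1
  ...   | inj₂ p≡q = p≢q p≡q

  prime∤product : ∀ {p} → Prime p → ∀ r (f : Fin r → ℕ) → (∀ i → ¬ p ∣ f i) → ¬ p ∣ prodFin r f
  prime∤product p-prime zero    f p∤f p∣1 = prime≢1 p-prime (∣1⇒≡1 p∣1)
  prime∤product p-prime (suc r) f p∤f p∣∏ with euclidsLemma (f Fin.zero) (prodFin r (λ i → f (Fin.suc i))) p-prime p∣∏
  ... | inj₁ p∣f₀ = p∤f Fin.zero p∣f₀
  ... | inj₂ p∣∏ᵣ = prime∤product p-prime r (λ i → f (Fin.suc i)) (λ i → p∤f (Fin.suc i)) p∣∏ᵣ

  prime-powers-∣ : ∀ r (p e : Fin r → ℕ) → (∀ i → Prime (p i)) → Injective _≡_ _≡_ p →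
                   ∀ X → (∀ i → p i ^ e i ∣ X) → prodFin r (λ i → p i ^ e i) ∣ X
  prime-powers-∣ zero    p e _       _     X _   = 1∣ X
  prime-powers-∣ (suc r) p e p-prime p-inj X p∣X =
    prime-power-∣ (p-prime Fin.zero) p₀∤rest (e Fin.zero) (p∣X Fin.zero)
      (prime-powers-∣ r (λ i → p (Fin.suc i)) (λ i → e (Fin.suc i)) (λ i → p-prime (Fin.suc i))
                      (λ eq → Fin-suc-injective (p-inj eq)) X (λ i → p∣X (Fin.suc i)))
    where
    p₀∤rest : ¬ p Fin.zero ∣ prodFin r (λ i → p (Fin.suc i) ^ e (Fin.suc i))
    p₀∤rest = prime∤product (p-prime Fin.zero) r _ (λ i →
      prime∤power-of-other-prime (p-prime Fin.zero) (p-prime (Fin.suc i)) (λ eq → zero≢suc (p-inj eq)) (e (Fin.suc i)))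

  ModEq-shift⇒∣ : ∀ {q} c a → ModEq q (c + a) c → q ∣ a
  ModEq-shift⇒∣ c a (k , inj₁ c+a≡c+kq) = divides k (+-cancelˡ-≡ c a _ c+a≡c+kq)
  ModEq-shift⇒∣ {q} c a (k , inj₂ c≡c+a+kq) = subst (q ∣_) (sym a≡0) (q ∣0)
    where
    a≡0 : a ≡ 0
    a≡0 = m+n≡0⇒m≡0 a (+-cancelˡ-≡ c (a + k * q) 0
            (trans (sym (+-assoc c a (k * q))) (trans (sym c≡c+a+kq) (sym (+-identityʳ c)))))

  crt-idempotent : (r : ℕ) (p e : Fin r → ℕ) → (∀ i → Prime (p i)) → Injective _≡_ _≡_ p →
                   (I : Subset r) (d : ℕ) →
                   (∀ i → i ∈ I → ModEq (p i ^ e i) d 0) → (∀ i → i ∉ I → ModEq (p i ^ e i) d 1) →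
                   ModEq (prodFin r (λ i → p i ^ e i)) (d * d) d
  crt-idempotent r p e _ _ I zero _ _ = 0 , inj₁ refl
  crt-idempotent r p e p-prime p-inj I (suc d) d≡0 d≡1
    with prime-powers-∣ r p e p-prime p-inj (suc d * d) factor∣
    where
    factor∣ : ∀ i → p i ^ e i ∣ suc d * d
    factor∣ i with i ∈? I
    ... | yes i∈I = ∣m⇒∣m*n d (ModEq-shift⇒∣ 0 (suc d) (d≡0 i i∈I))
    ... | no  i∉I = ∣n⇒∣m*n (suc d) (ModEq-shift⇒∣ 1 d (d≡1 i i∉I))
  ... | divides c d[d-1]≡c·m = c , inj₁ (trans (*-suc (suc d) d) (cong (suc d +_) d[d-1]≡c·m))

open PrimePowerProducts using (crt-idempotent)

mainTheorem7 : (r : ℕ) (p e : Fin r → ℕ) →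
    (∀ i → Prime (p i)) → Injective _≡_ _≡_ p → (∀ i → 1 ≤ e i) →
    (m : ℕ) → m ≡ prodFin r (λ i → p i ^ e i) →
    (I : Subset r) (d : ℕ) → d < m →
    (∀ i → i ∈ I → ModEq (p i ^ e i) d 0) →
    (∀ i → i ∉ I → ModEq (p i ^ e i) d 1) →
    ((∀ x → InMulUnits m d x → InComponent m d x)
     × (∀ f → IsIdempotent m f → (∀ x → InMulUnits m f x → InComponent m d x) →
          ∀ x → InMulUnits m f x ⇔ InMulUnits m d x)
     × (∀ v → (InComponent m d v × InCycle m v) ⇔ InMulUnits m d v))
mainTheorem7 r p e p-prime p-inj _ m m≡∏ I d d<m d≡0 d≡1 =
  dU⊆component , unique-idempotent-class , cyclic-in-component⇔dU
  where
  instance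
    m≢0 : NonZero m
    m≢0 = >-nonZero (≤-trans (s≤s z≤n) d<m)
  d-idem : IsIdempotent m d
  d-idem = d<m , subst (λ n → ModEq n (d * d) d) (sym m≡∏) (crt-idempotent r p e p-prime p-inj I d d≡0 d≡1)
  open IdempotentComponent m d d-idem
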